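{- Let $n\ge 2$ be even, and let $T=(H_1,\dots,H_{n/2})$ be a tournament on $n$ players with $H=K_2$ consisting of exactly $\frac{n}{2}$ rounds, with feasibility graph $G$ and complement $\bar G$. Then $T$ cannot be extended (i.e., $G$ has no perfect matching) if and only if $\bar G$ is (isomorphic to) the complete bipartite graph $K_{\frac n2,\frac n2}$ and $\frac n2$ is odd.
   Context: For a graph $H$ and $n\ge 2$, an $H$-factor of a graph on $n$ vertices is a union of vertex-disjoint copies of $H$ covering every vertex. A tournament with $r$ rounds on $n$ players with $H$ is a tuple $(H_1,\dots,H_r)$ of $H$-factors of the complete graph $K_n$ such that each edge of $K_n$ lies in at most one $H_i$. For $H=K_2$, an $H$-factor is a perfect matching. The feasibility graph of the tournament is $G=K_n\setminus\bigcup_{i\le r}H_i$ (same vertex set, edges of $K_n$ lying in no $H_i$); its complement $\bar G$ is the graph on the same vertex set whose edges are those lying in some $H_i$. The tournament is extendable if $G$ contains an $H$-factor. -}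

module Defs where

open import Level using (0ℓ)
open import Data.Nat using (ℕ; _<_; _≤_; _+_)
open import Data.Fin using (Fin; toℕ)
open import Data.Product using (Σ; _×_)
open import Data.Sum using (_⊎_)
open import Relation.Nullary using (¬_)
open import Relation.Binary.PropositionalEquality using (_≡_; _≢_)
open import Function.Bundles using (_↔_; _⇔_; Inverse)

Graph : ℕ → Set₁
Graph n = Fin n → Fin n → Set

K : (n : ℕ) → Graph n
K n v w = v ≢ w

record PerfectMatching {n : ℕ} (G : Graph n) : Set where
  field
    partner    : Fin n → Fin n
    involutive : ∀ v → partner (partner v) ≡ v
    no-fixed   : ∀ v → partner v ≢ v
    in-graph   : ∀ v → G v (partner v)
open PerfectMatching public

InMatching : ∀ {n} {G : Graph n} → PerfectMatching G → Fin n → Fin n → Set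
InMatching M v w = partner M v ≡ w

-- A tournament with r rounds on n players with H = K₂: r perfect matchings
-- of K_n such that every edge of K_n lies in at most one of them.
record Tournament (n r : ℕ) : Set where
  field
    round    : Fin r → PerfectMatching (K n)
    disjoint : ∀ i j v w → InMatching (round i) v w → InMatching (round j) v w → i ≡ j
open Tournament public

-- Complement Ḡ of the feasibility graph: edges lying in some round.
coFeasibility : ∀ {n r} → Tournament n r → Graph n
coFeasibility T v w = Σ (Fin _) λ i → InMatching (round T i) v w

feasibility : ∀ {n r} → Tournament n r → Graph n
feasibility T v w = v ≢ w × ¬ coFeasibility T v w

Extendable : ∀ {n r} → Tournament n r → Set
Extendable T = PerfectMatching (feasibility T)

CompleteBipartite : (a b : ℕ) → Graph (a + b)
CompleteBipartite a b v w = (toℕ v < a × a ≤ toℕ w) ⊎ (a ≤ toℕ v × toℕ w < a)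

record _≅_ {n m : ℕ} (G : Graph n) (G' : Graph m) : Set where
  field
    bij   : Fin n ↔ Fin m
    edges : ∀ v w → G v w ⇔ G' (Inverse.to bij v) (Inverse.to bij w)

-- The feasibility graph G of a tournament with k rounds on 2k players is (k − 1)-regular
-- on 2k vertices. Enlarge a matching of G along augmenting paths of length 1, 3 or 5
-- between two unmatched vertices u and v. When none exists, counting shows that {u, v},
-- N(v) and the mates of N(u) partition the vertex set. With this, the absence of 5-paths
-- shows that the mate of a neighbour of u has all its neighbours in {u} ∪ N(u), and by
-- regularity N(u) and N(v) are disjoint. Hence N(u) is closed under taking mates and no
-- edge of G leaves {u} ∪ N(u): the k − 1 vertices of N(u) are paired off, so k is odd,
-- and the k-regular complement Ḡ contains every edge between {u} ∪ N(u) and the other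
-- k vertices, so Ḡ is K_{k,k}. Conversely, if Ḡ ≅ K_{k,k}, a perfect matching of G
-- pairs up the k vertices of one side, so k is even.

module Submission where

open import Level using (0ℓ)
open import Data.Nat using (ℕ; zero; suc; _+_; _≤_; _<_; z≤n; s≤s)
import Data.Nat as ℕ
open import Data.Nat.Properties
  using (≤-antisym; ≤-reflexive; m≤n⇒m≤1+n; n≤1+n; m≤m+n; <⇒≱; <⇒≢; +-comm; +-suc; +-identityʳ;
         module ≤-Reasoning)
import Data.Nat.Properties as ℕₚ
open import Data.Nat.Divisibility
  using (_∣_; divides; _∣0; ∣-refl; ∣m∣n⇒∣m+n; ∣m+n∣m⇒∣n; ∣1⇒≡1; >⇒∤)
open import Data.Nat.Induction using (<-wellFounded)
open import Induction.WellFounded using (Acc; acc)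
open import Data.Fin using (Fin; zero; suc; toℕ)
import Data.Fin as Fin
open import Data.Fin.Properties using (_≟_; any?; suc-injective)
import Data.Fin.Properties as Finₚ
open import Data.Bool using (if_then_else_)
open import Data.Empty using (⊥-elim)
open import Data.Unit using (tt)
open import Data.Product using (∃; ∃₂; _×_; _,_; proj₁; proj₂)
import Data.Product as Product
open import Data.Sum using (_⊎_; inj₁; inj₂)
import Data.Sum as Sum
open import Function using (_∘_; id)
open import Function.Bundles using (_↔_; mk↔ₛ′; _⇔_; mk⇔; Equivalence; Inverse)
open import Relation.Binary.Definitions using (tri<; tri≈; tri>)
open import Relation.Binary.PropositionalEquality
open import Relation.Nullary using (¬_; ¬?; Dec; yes; no; does; contradiction; _×-dec_)
open import Relation.Nullary.Decidable using (decidable-stable)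
open import Relation.Unary using (Pred; Decidable; _⊆_; _≐_; _∪_; _∩_; ∁; Empty)
open import Relation.Unary.Properties using (_∪?_; _∩?_; ∁?; U?)

open import Defs

private variable
  m n : ℕ

retraction⇒injective : {A B : Set} {f : A → B} (g : B → A) → (∀ x → g (f x) ≡ x) →
                       ∀ {x y} → f x ≡ f y → x ≡ y
retraction⇒injective g gf {x} {y} fx≡fy = trans (sym (gf x)) (trans (cong g fx≡fy) (gf y))

2∣n+n : ∀ n → 2 ∣ n + n
2∣n+n n = divides n (trans (cong (n +_) (sym (+-identityʳ n))) (ℕₚ.*-comm 2 n))

2∣n⇒2∤1+n : 2 ∣ n → ¬ 2 ∣ suc n
2∣n⇒2∤1+n {n} 2∣n 2∣1+n =
  >⇒∤ (s≤s (s≤s z≤n)) (∣m+n∣m⇒∣n (subst (2 ∣_) (+-comm 1 n) 2∣1+n) 2∣n)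

-- Counting decidable subsets of Fin n

count : {P : Pred (Fin n) 0ℓ} → Decidable P → ℕ
count {n = zero}  P? = 0
count {n = suc n} P? = (if does (P? zero) then suc else id) (count (P? ∘ suc))

count-mono : {P Q : Pred (Fin n) 0ℓ} (P? : Decidable P) (Q? : Decidable Q) → P ⊆ Q → count P? ≤ count Q?
count-mono {n = zero}  P? Q? P⊆Q = z≤n
count-mono {n = suc n} P? Q? P⊆Q with P? zero | Q? zero
... | yes _ | yes _  = s≤s (count-mono (P? ∘ suc) (Q? ∘ suc) P⊆Q)
... | yes p | no ¬q  = contradiction (P⊆Q p) ¬q
... | no _  | yes _  = m≤n⇒m≤1+n (count-mono (P? ∘ suc) (Q? ∘ suc) P⊆Q)
... | no _  | no _   = count-mono (P? ∘ suc) (Q? ∘ suc) P⊆Q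

count-cong : {P Q : Pred (Fin n) 0ℓ} (P? : Decidable P) (Q? : Decidable Q) → P ≐ Q → count P? ≡ count Q?
count-cong P? Q? (P⊆Q , Q⊆P) = ≤-antisym (count-mono P? Q? P⊆Q) (count-mono Q? P? Q⊆P)

count-∪-∩ : {P Q : Pred (Fin n) 0ℓ} (P? : Decidable P) (Q? : Decidable Q) →
            count (P? ∪? Q?) + count (P? ∩? Q?) ≡ count P? + count Q?
count-∪-∩ {n = zero}  P? Q? = refl
count-∪-∩ {n = suc n} P? Q? with P? zero | Q? zero | count-∪-∩ (P? ∘ suc) (Q? ∘ suc)
... | yes _ | yes _ | ih = cong suc (trans (+-suc _ _) (trans (cong suc ih) (sym (+-suc _ _))))
... | yes _ | no _  | ih = cong suc ih
... | no _  | yes _ | ih = trans (cong suc ih) (sym (+-suc _ _))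
... | no _  | no _  | ih = ih

count-U : count (U? {A = Fin n}) ≡ n
count-U {n = zero}  = refl
count-U {n = suc n} = cong suc count-U

count-empty : {P : Pred (Fin n) 0ℓ} (P? : Decidable P) → Empty P → count P? ≡ 0
count-empty {n = zero}  P? _ = refl
count-empty {n = suc n} P? ∅ with P? zero
... | yes p = contradiction p (∅ zero)
... | no  _ = count-empty (P? ∘ suc) (∅ ∘ suc)

count-∪ : {P Q : Pred (Fin n) 0ℓ} (P? : Decidable P) (Q? : Decidable Q) →
          Empty (P ∩ Q) → count (P? ∪? Q?) ≡ count P? + count Q?
count-∪ P? Q? P∩Q≡∅ = begin
  count (P? ∪? Q?)                    ≡⟨ +-identityʳ _ ⟨
  count (P? ∪? Q?) + 0                ≡⟨ cong (count (P? ∪? Q?) +_) (count-empty (P? ∩? Q?) P∩Q≡∅) ⟨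
  count (P? ∪? Q?) + count (P? ∩? Q?) ≡⟨ count-∪-∩ P? Q? ⟩
  count P? + count Q?                 ∎
  where open ≡-Reasoning

count-∪≤ : {P Q : Pred (Fin n) 0ℓ} (P? : Decidable P) (Q? : Decidable Q) →
           count (P? ∪? Q?) ≤ count P? + count Q?
count-∪≤ P? Q? = subst (count (P? ∪? Q?) ≤_) (count-∪-∩ P? Q?) (m≤m+n _ _)

count-singleton : (x : Fin n) → count (_≟ x) ≡ 1
count-singleton {n = suc n} zero    = cong suc (count-empty (λ (y : Fin n) → suc y ≟ zero) λ _ ())
count-singleton {n = suc n} (suc x) =
  trans (count-cong _ (_≟ x) (suc-injective , cong suc)) (count-singleton x)

count-∁ : {P : Pred (Fin n) 0ℓ} (P? : Decidable P) → count P? + count (∁? P?) ≡ n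
count-∁ {n = n} {P = P} P? = begin
  count P? + count (∁? P?)  ≡⟨ count-∪ P? (∁? P?) (λ _ (p , ¬p) → ¬p p) ⟨
  count (P? ∪? ∁? P?)       ≡⟨ count-cong (P? ∪? ∁? P?) U? ((λ _ → tt) , λ {x} _ → P-or-∁P x) ⟩
  count (U? {A = Fin n})    ≡⟨ count-U ⟩
  n                         ∎
  where
  open ≡-Reasoning
  P-or-∁P : ∀ x → (P ∪ ∁ P) x
  P-or-∁P x with P? x
  ... | yes p = inj₁ p
  ... | no ¬p = inj₂ ¬p

count-∁-half : ∀ {k} {P : Pred (Fin (k + k)) 0ℓ} (P? : Decidable P) → count P? ≡ k → count (∁? P?) ≡ k
count-∁-half {k} P? |P|≡k = ℕₚ.+-cancelˡ-≡ k _ _ (trans (cong (_+ count (∁? P?)) (sym |P|≡k)) (count-∁ P?))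

count-remove : {P : Pred (Fin n) 0ℓ} (P? : Decidable P) {x : Fin n} → P x →
               count P? ≡ suc (count (P? ∩? ∁? (_≟ x)))
count-remove {P = P} P? {x} px = begin
  count P?                   ≡⟨ count-cong P? (P∖x? ∪? (_≟ x)) (split , merge) ⟩
  count (P∖x? ∪? (_≟ x))     ≡⟨ count-∪ P∖x? (_≟ x) (λ _ ((_ , y≢x) , y≡x) → y≢x y≡x) ⟩
  count P∖x? + count (_≟ x)  ≡⟨ cong (count P∖x? +_) (count-singleton x) ⟩
  count P∖x? + 1             ≡⟨ +-comm _ 1 ⟩
  suc (count P∖x?)           ∎
  where
  open ≡-Reasoning
  P∖x? : Decidable (P ∩ ∁ (_≡ x))
  P∖x? = P? ∩? ∁? (_≟ x)
  split : P ⊆ (P ∩ ∁ (_≡ x)) ∪ (_≡ x)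
  split {y} py with y ≟ x
  ... | yes y≡x = inj₂ y≡x
  ... | no  y≢x = inj₁ (py , y≢x)
  merge : (P ∩ ∁ (_≡ x)) ∪ (_≡ x) ⊆ P
  merge (inj₁ (py , _)) = py
  merge (inj₂ refl)     = px

count-strict : {P Q : Pred (Fin n) 0ℓ} (P? : Decidable P) (Q? : Decidable Q) →
               P ⊆ Q → {x : Fin n} → Q x → ¬ P x → count P? < count Q?
count-strict P? Q? P⊆Q {x} qx ¬px = subst (count P? <_) (sym (count-remove Q? qx))
  (s≤s (count-mono P? (Q? ∩? ∁? (_≟ x)) λ py → P⊆Q py , λ { refl → ¬px py }))

⊆-by-count : {P Q : Pred (Fin n) 0ℓ} (P? : Decidable P) (Q? : Decidable Q) →
             P ⊆ Q → count Q? ≤ count P? → Q ⊆ P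
⊆-by-count P? Q? P⊆Q Q≤P {x} qx with P? x
... | yes px = px
... | no ¬px = contradiction Q≤P (<⇒≱ (count-strict P? Q? P⊆Q qx ¬px))

0<count⇒∃ : {P : Pred (Fin n) 0ℓ} (P? : Decidable P) → 0 < count P? → ∃ P
0<count⇒∃ P? 0<c with any? P?
... | yes ∃p = ∃p
... | no ¬∃p = contradiction (count-empty P? λ x px → ¬∃p (x , px)) (<⇒≢ 0<c ∘ sym)

count-injection : {P : Pred (Fin n) 0ℓ} {Q : Pred (Fin m) 0ℓ} (P? : Decidable P) (Q? : Decidable Q)
                  (f : Fin n → Fin m) → (∀ {x} → P x → Q (f x)) →
                  (∀ {x y} → P x → P y → f x ≡ f y → x ≡ y) → count P? ≤ count Q?
count-injection {n = zero}  P? Q? f maps injective = z≤n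
count-injection {n = suc n} P? Q? f maps injective with P? zero
... | no  _  = count-injection (P? ∘ suc) Q? (f ∘ suc) maps (λ px py → suc-injective ∘ injective px py)
... | yes p₀ = subst (suc _ ≤_) (sym (count-remove Q? (maps p₀)))
  (s≤s (count-injection (P? ∘ suc) (Q? ∩? ∁? (_≟ f zero)) (f ∘ suc)
    (λ px → maps px , λ f≡f₀ → Finₚ.0≢1+n (injective p₀ px (sym f≡f₀)))
    (λ px py → suc-injective ∘ injective px py)))

image? : (f : Fin m → Fin n) → Decidable (λ y → ∃ λ x → f x ≡ y)
image? f y = any? λ x → f x ≟ y

count-image≤ : (f : Fin m → Fin n) → count (image? f) ≤ m
count-image≤ {m = zero}  f = ≤-reflexive (count-empty (image? f) λ _ ())
count-image≤ {m = suc m} f = begin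
  count (image? f)                 ≤⟨ count-mono (image? f) (f₀? ∪? f₊?) split ⟩
  count (f₀? ∪? f₊?)               ≤⟨ count-∪≤ f₀? f₊? ⟩
  count f₀? + count f₊?            ≡⟨ cong (_+ count f₊?) (count-singleton (f zero)) ⟩
  suc (count f₊?)                  ≤⟨ s≤s (count-image≤ (f ∘ suc)) ⟩
  suc m                            ∎
  where
  open ≤-Reasoning
  f₀? : Decidable (_≡ f zero)
  f₀? = _≟ f zero
  f₊? : Decidable (λ y → ∃ λ x → f (suc x) ≡ y)
  f₊? = image? (f ∘ suc)
  split : (λ y → ∃ λ x → f x ≡ y) ⊆ (_≡ f zero) ∪ (λ y → ∃ λ x → f (suc x) ≡ y)
  split (zero  , refl) = inj₁ refl
  split (suc x , refl) = inj₂ (x , refl)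

count-preimage : {P : Pred (Fin n) 0ℓ} (P? : Decidable P) (f g : Fin n → Fin n) →
                 (∀ x → f (g x) ≡ x) → (∀ x → g (f x) ≡ x) → count (P? ∘ f) ≡ count P?
count-preimage {P = P} P? f g fg gf = ≤-antisym
  (count-injection (P? ∘ f) P? f id λ _ _ → retraction⇒injective g gf)
  (count-injection P? (P? ∘ f) g (λ {x} px → subst P (sym (fg x)) px) λ _ _ → retraction⇒injective f fg)

count-toℕ< : ∀ m → m ≤ n → count (λ (i : Fin n) → toℕ i ℕ.<? m) ≡ m
count-toℕ< {n = n}     zero    _         = count-empty (λ (i : Fin n) → toℕ i ℕ.<? 0) λ _ ()
count-toℕ< {n = suc n} (suc m) (s≤s m≤n) with toℕ {suc n} zero ℕ.<? suc m
... | no  0≮1+m = contradiction (s≤s z≤n) 0≮1+m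
... | yes _     = cong suc (trans
  (count-cong (λ (i : Fin n) → toℕ (suc i) ℕ.<? suc m) (λ i → toℕ i ℕ.<? m) (ℕ.s<s⁻¹ , s≤s))
  (count-toℕ< m m≤n))

even-count : (f : Fin n → Fin n) → (∀ x → f (f x) ≡ x) → {P : Pred (Fin n) 0ℓ} (P? : Decidable P) →
             (∀ {x} → P x → P (f x)) → (∀ {x} → P x → f x ≢ x) → 2 ∣ count P?
even-count {n = n} f involutive P? = go P? (<-wellFounded (count P?))
  where
  f-injective : ∀ {x y} → f x ≡ f y → x ≡ y
  f-injective = retraction⇒injective f involutive
  go : {P : Pred (Fin n) 0ℓ} (P? : Decidable P) → Acc _<_ (count P?) →
       (∀ {x} → P x → P (f x)) → (∀ {x} → P x → f x ≢ x) → 2 ∣ count P?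
  go {P} P? (acc rec) closed no-fix with any? P?
  ... | no ¬∃p = subst (2 ∣_) (sym (count-empty P? λ x px → ¬∃p (x , px))) (2 ∣0)
  ... | yes (x , px) = subst (2 ∣_) (sym |P|≡2+|P₂|) (∣m∣n⇒∣m+n (∣-refl {2}) 2∣|P₂|)
    where
    P₁? : Decidable (P ∩ ∁ (_≡ x))
    P₁? = P? ∩? ∁? (_≟ x)
    P₂? : Decidable ((P ∩ ∁ (_≡ x)) ∩ ∁ (_≡ f x))
    P₂? = P₁? ∩? ∁? (_≟ f x)
    |P|≡2+|P₂| : count P? ≡ 2 + count P₂?
    |P|≡2+|P₂| = trans (count-remove P? px) (cong suc (count-remove P₁? (closed px , no-fix px)))
    closed₂ : ∀ {y} → ((P ∩ ∁ (_≡ x)) ∩ ∁ (_≡ f x)) y →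
                      ((P ∩ ∁ (_≡ x)) ∩ ∁ (_≡ f x)) (f y)
    closed₂ ((py , y≢x) , y≢fx) =
      (closed py , λ fy≡x → y≢fx (f-injective (trans fy≡x (sym (involutive x))))) , y≢x ∘ f-injective
    2∣|P₂| : 2 ∣ count P₂?
    2∣|P₂| = go P₂? (rec (subst (count P₂? <_) (sym |P|≡2+|P₂|) (n≤1+n _))) closed₂
      λ ((py , _) , _) → no-fix py

-- Moving a k-element subset of Fin (k + k) to the first half

rank : {P : Pred (Fin n) 0ℓ} → Decidable P → Fin n → ℕ
rank P? v = count (P? ∩? (Finₚ._<? v))

rank<count : {P : Pred (Fin n) 0ℓ} (P? : Decidable P) {v : Fin n} → P v → rank P? v < count P?
rank<count P? pv = count-strict (P? ∩? (Finₚ._<? _)) P? proj₁ pv λ (_ , v<v) → Finₚ.<-irrefl refl v<v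

rank-strictMono : {P : Pred (Fin n) 0ℓ} (P? : Decidable P) {v w : Fin n} → P v → v Fin.< w →
                  rank P? v < rank P? w
rank-strictMono P? pv v<w = count-strict (P? ∩? (Finₚ._<? _)) (P? ∩? (Finₚ._<? _))
  (λ (pu , u<v) → pu , Finₚ.<-trans u<v v<w) (pv , v<w) λ (_ , v<v) → Finₚ.<-irrefl refl v<v

rank-injective : {P : Pred (Fin n) 0ℓ} (P? : Decidable P) {v w : Fin n} → P v → P w →
                 rank P? v ≡ rank P? w → v ≡ w
rank-injective P? {v} {w} pv pw rv≡rw with Finₚ.<-cmp v w
... | tri< v<w _ _ = contradiction rv≡rw (<⇒≢ (rank-strictMono P? pv v<w))
... | tri≈ _ v≡w _ = v≡w
... | tri> _ _ w<v = contradiction (sym rv≡rw) (<⇒≢ (rank-strictMono P? pw w<v))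

injective⇒surjective : (f : Fin n → Fin n) → (∀ {x y} → f x ≡ f y → x ≡ y) →
                       ∀ y → ∃ λ x → f x ≡ y
injective⇒surjective {suc n} f f-injective y with any? (λ x → f x ≟ y)
... | yes found = found
... | no ¬found = contradiction (Finₚ.injective⇒≤ punch-injective) ℕₚ.1+n≰n
  where
  punch : Fin (suc n) → Fin n
  punch x = Fin.punchOut {i = y} {j = f x} λ y≡fx → ¬found (x , sym y≡fx)
  punch-injective : ∀ {x z} → punch x ≡ punch z → x ≡ z
  punch-injective = f-injective ∘ Finₚ.punchOut-injective {i = y} _ _

injective⇒↔ : (f : Fin n → Fin n) → (∀ {x y} → f x ≡ f y → x ≡ y) → Fin n ↔ Fin n
injective⇒↔ f f-injective = mk↔ₛ′ f (proj₁ ∘ preimage) (proj₂ ∘ preimage)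
  λ x → f-injective (proj₂ (preimage (f x)))
  where
  preimage : ∀ y → ∃ λ x → f x ≡ y
  preimage = injective⇒surjective f f-injective

module _ {k : ℕ} {A : Pred (Fin (k + k)) 0ℓ} (A? : Decidable A) (|A|≡k : count A? ≡ k) where

  private
    rank<k : {P : Pred (Fin (k + k)) 0ℓ} (P? : Decidable P) → count P? ≡ k → ∀ {v} → P v → rank P? v < k
    rank<k P? |P|≡k pv = subst (rank P? _ <_) |P|≡k (rank<count P? pv)

    |∁A|≡k : count (∁? A?) ≡ k
    |∁A|≡k = count-∁-half A? |A|≡k

  sortHalves : Fin (k + k) → Fin (k + k)
  sortHalves v with A? v
  ... | yes a = Fin.fromℕ< (rank<k A? |A|≡k a) Fin.↑ˡ k
  ... | no ¬a = k Fin.↑ʳ Fin.fromℕ< (rank<k (∁? A?) |∁A|≡k ¬a)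

  toℕ-sortHalves-∈ : ∀ {v} → A v → toℕ (sortHalves v) ≡ rank A? v
  toℕ-sortHalves-∈ {v} a with A? v
  ... | yes a′ = trans (Finₚ.toℕ-↑ˡ _ k) (Finₚ.toℕ-fromℕ< (rank<k A? |A|≡k a′))
  ... | no ¬a  = contradiction a ¬a

  toℕ-sortHalves-∉ : ∀ {v} → ¬ A v → toℕ (sortHalves v) ≡ k + rank (∁? A?) v
  toℕ-sortHalves-∉ {v} ¬a with A? v
  ... | yes a  = contradiction a ¬a
  ... | no ¬a′ =
    trans (Finₚ.toℕ-↑ʳ k _) (cong (k +_) (Finₚ.toℕ-fromℕ< (rank<k (∁? A?) |∁A|≡k ¬a′)))

  sortHalves-< : ∀ {v} → A v → toℕ (sortHalves v) < k
  sortHalves-< a = subst (_< k) (sym (toℕ-sortHalves-∈ a)) (rank<k A? |A|≡k a)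

  sortHalves-≥ : ∀ {v} → ¬ A v → k ≤ toℕ (sortHalves v)
  sortHalves-≥ ¬a = subst (k ≤_) (sym (toℕ-sortHalves-∉ ¬a)) (m≤m+n k _)

  sortHalves-injective : ∀ {v w} → sortHalves v ≡ sortHalves w → v ≡ w
  sortHalves-injective {v} {w} σv≡σw = by-cases (A? v) (A? w)
    where
    σv≡σw′ : toℕ (sortHalves v) ≡ toℕ (sortHalves w)
    σv≡σw′ = cong toℕ σv≡σw
    by-cases : Dec (A v) → Dec (A w) → v ≡ w
    by-cases (yes a) (yes b) =
      rank-injective A? a b (trans (sym (toℕ-sortHalves-∈ a)) (trans σv≡σw′ (toℕ-sortHalves-∈ b)))
    by-cases (yes a) (no ¬b) =
      contradiction (subst (_< k) σv≡σw′ (sortHalves-< a)) (ℕₚ.≤⇒≯ (sortHalves-≥ ¬b))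
    by-cases (no ¬a) (yes b) =
      contradiction (subst (_< k) (sym σv≡σw′) (sortHalves-< b)) (ℕₚ.≤⇒≯ (sortHalves-≥ ¬a))
    by-cases (no ¬a) (no ¬b) = rank-injective (∁? A?) ¬a ¬b (ℕₚ.+-cancelˡ-≡ k _ _
      (trans (sym (toℕ-sortHalves-∉ ¬a)) (trans σv≡σw′ (toℕ-sortHalves-∉ ¬b))))

  ≅-CompleteBipartite : {H : Graph (k + k)} →
    (∀ v w → H v w ⇔ ((A v × ¬ A w) ⊎ (¬ A v × A w))) → H ≅ CompleteBipartite k k
  ≅-CompleteBipartite H⇔ = record
    { bij   = injective⇒↔ sortHalves sortHalves-injective
    ; edges = λ v w → mk⇔
        (Sum.map (Product.map sortHalves-< sortHalves-≥) (Product.map sortHalves-≥ sortHalves-<)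
          ∘ Equivalence.to (H⇔ v w))
        (Equivalence.from (H⇔ v w)
          ∘ Sum.map (Product.map ∈-from-< ∉-from-≥) (Product.map ∉-from-≥ ∈-from-<))
    }
    where
    ∈-from-< : ∀ {v} → toℕ (sortHalves v) < k → A v
    ∈-from-< {v} σv<k = decidable-stable (A? v) λ ¬a → ℕₚ.≤⇒≯ (sortHalves-≥ ¬a) σv<k
    ∉-from-≥ : ∀ {v} → k ≤ toℕ (sortHalves v) → ¬ A v
    ∉-from-≥ k≤σv a = ℕₚ.≤⇒≯ k≤σv (sortHalves-< a)

-- Partial matchings and augmenting paths

record PartialMatching {n : ℕ} (G : Graph n) : Set where
  field
    mate            : Fin n → Fin n
    mate-involutive : ∀ v → mate (mate v) ≡ v
    mate-adjacent   : ∀ v → mate v ≢ v → G v (mate v)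

  Unmatched : Fin n → Set
  Unmatched v = mate v ≡ v

  mate-injective : ∀ {v w} → mate v ≡ mate w → v ≡ w
  mate-injective = retraction⇒injective mate mate-involutive

  unmatched≢matched : ∀ {a x} → Unmatched a → ¬ Unmatched x → a ≢ x
  unmatched≢matched a-unmatched x-matched refl = x-matched a-unmatched

  mate-matched : ∀ {x} → ¬ Unmatched x → ¬ Unmatched (mate x)
  mate-matched {x} x-matched mx-unmatched = x-matched (trans (sym mx-unmatched) (mate-involutive x))

open PartialMatching
  using (mate; mate-involutive; mate-adjacent; Unmatched; mate-injective; unmatched≢matched; mate-matched)

module Augmenting {n : ℕ} {G : Graph n}
  (G-symmetric : ∀ {v w} → G v w → G w v) (G-irreflexive : ∀ {v} → ¬ G v v) where

  empty-matching : PartialMatching G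
  empty-matching = record
    { mate = id ; mate-involutive = λ _ → refl ; mate-adjacent = λ v v≢v → contradiction refl v≢v }

  module Link (M : PartialMatching G) {a b : Fin n} (a-unmatched : Unmatched M a) (a≢b : a ≢ b) (Gab : G a b) where

    mate′ : Fin n → Fin n
    mate′ y with y ≟ a | y ≟ b | y ≟ mate M b
    ... | yes _ | _     | _     = b
    ... | no _  | yes _ | _     = a
    ... | no _  | no _  | yes _ = y
    ... | no _  | no _  | no _  = mate M y

    mate′-a : mate′ a ≡ b
    mate′-a with a ≟ a | a ≟ b | a ≟ mate M b
    ... | yes _  | _ | _ = refl
    ... | no a≢a | _ | _ = contradiction refl a≢a

    mate′-b : mate′ b ≡ a
    mate′-b with b ≟ a | b ≟ b | b ≟ mate M b
    ... | yes b≡a | _      | _ = contradiction (sym b≡a) a≢b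
    ... | no _    | yes _  | _ = refl
    ... | no _    | no b≢b | _ = contradiction refl b≢b

    mate-unchanged : ∀ {y} → y ≢ a → y ≢ b → y ≢ mate M b → mate′ y ≡ mate M y
    mate-unchanged {y} y≢a y≢b y≢mb with y ≟ a | y ≟ b | y ≟ mate M b
    ... | yes y≡a | _       | _        = contradiction y≡a y≢a
    ... | no _    | yes y≡b | _        = contradiction y≡b y≢b
    ... | no _    | no _    | yes y≡mb = contradiction y≡mb y≢mb
    ... | no _    | no _    | no _     = refl

    mate′-involutive : ∀ y → mate′ (mate′ y) ≡ y
    mate′-involutive y with y ≟ a | y ≟ b | y ≟ mate M b
    ... | yes refl | _        | _        = mate′-b
    ... | no _     | yes refl | _        = mate′-a
    ... | no y≢a   | no y≢b   | yes y≡mb with y ≟ a | y ≟ b | y ≟ mate M b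
    ...   | yes y≡a | _       | _       = contradiction y≡a y≢a
    ...   | no _    | yes y≡b | _       = contradiction y≡b y≢b
    ...   | no _    | no _    | yes _   = refl
    ...   | no _    | no _    | no y≢mb = contradiction y≡mb y≢mb
    mate′-involutive y | no y≢a | no y≢b | no y≢mb =
      trans (mate-unchanged my≢a my≢b (y≢b ∘ mate-injective M)) (mate-involutive M y)
      where
      my≢a : mate M y ≢ a
      my≢a my≡a = y≢a (mate-injective M (trans my≡a (sym a-unmatched)))
      my≢b : mate M y ≢ b
      my≢b my≡b = y≢mb (trans (sym (mate-involutive M y)) (cong (mate M) my≡b))

    mate′-adjacent : ∀ y → mate′ y ≢ y → G y (mate′ y)
    mate′-adjacent y with y ≟ a | y ≟ b | y ≟ mate M b
    ... | yes refl | _        | _     = λ _ → Gab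
    ... | no _     | yes refl | _     = λ _ → G-symmetric Gab
    ... | no _     | no _     | yes _ = λ y≢y → contradiction refl y≢y
    ... | no _     | no _     | no _  = mate-adjacent M y

    matching : PartialMatching G
    matching = record { mate = mate′ ; mate-involutive = mate′-involutive ; mate-adjacent = mate′-adjacent }

    unmatched-before : ∀ {y} → Unmatched matching y → y ≢ a × y ≢ b × (Unmatched M y ⊎ y ≡ mate M b)
    unmatched-before {y} with y ≟ a | y ≟ b | y ≟ mate M b
    ... | yes refl | _        | _        = λ b≡a → contradiction (sym b≡a) a≢b
    ... | no _     | yes refl | _        = λ a≡b → contradiction a≡b a≢b
    ... | no y≢a   | no y≢b   | yes y≡mb = λ _ → y≢a , y≢b , inj₂ y≡mb
    ... | no y≢a   | no y≢b   | no _     = λ my≡y → y≢a , y≢b , inj₁ my≡y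

    module _ (b-matched : ¬ Unmatched M b) where

      still-unmatched : ∀ {y} → Unmatched M y → y ≢ a → Unmatched matching y
      still-unmatched y-unmatched y≢a = trans
        (mate-unchanged y≢a (unmatched≢matched M y-unmatched b-matched)
          (unmatched≢matched M y-unmatched (mate-matched M b-matched)))
        y-unmatched

      mate-unmatched : Unmatched matching (mate M b)
      mate-unmatched with mate M b ≟ a | mate M b ≟ b | mate M b ≟ mate M b
      ... | yes mb≡a | _        | _        = contradiction
            (trans (sym (mate-involutive M b)) (trans (cong (mate M) mb≡a) a-unmatched)) (a≢b ∘ sym)
      ... | no _     | yes mb≡b | _        = contradiction mb≡b b-matched
      ... | no _     | no _     | yes _    = refl
      ... | no _     | no _     | no mb≢mb = contradiction refl mb≢mb

  link : (M : PartialMatching G) {a b : Fin n} → Unmatched M a → a ≢ b → G a b → PartialMatching G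
  link = Link.matching

  Improves : PartialMatching G → PartialMatching G → Fin n → Set
  Improves M′ M a = ∀ {y} → Unmatched M′ y → Unmatched M y × y ≢ a

  improves-by-edge : (M : PartialMatching G) {a b : Fin n} (a-unmatched : Unmatched M a) → Unmatched M b →
                     (a≢b : a ≢ b) (Gab : G a b) → Improves (link M a-unmatched a≢b Gab) M a
  improves-by-edge M a-unmatched b-unmatched a≢b Gab y-unmatched
    with Link.unmatched-before M a-unmatched a≢b Gab y-unmatched
  ... | y≢a , _   , inj₁ y-unmatched-before = y-unmatched-before , y≢a
  ... | _   , y≢b , inj₂ y≡mb               = contradiction (trans y≡mb b-unmatched) y≢b

  improves-through-link : (M : PartialMatching G) {a x : Fin n} (a-unmatched : Unmatched M a)
    (a≢x : a ≢ x) (Gax : G a x) → (M′ : PartialMatching G) →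
    Improves M′ (link M a-unmatched a≢x Gax) (mate M x) → Improves M′ M a
  improves-through-link M a-unmatched a≢x Gax M′ M′-improves y-unmatched with M′-improves y-unmatched
  ... | y-unmatched-link , y≢mx with Link.unmatched-before M a-unmatched a≢x Gax y-unmatched-link
  ...   | y≢a , _ , inj₁ y-unmatched-before = y-unmatched-before , y≢a
  ...   | _   , _ , inj₂ y≡mx               = contradiction y≡mx y≢mx

  augment-path-3 : (M : PartialMatching G) {u w x : Fin n} → Unmatched M u → Unmatched M w → u ≢ w →
                   G u x → ¬ Unmatched M x → G (mate M x) w → ∃ λ M′ → Improves M′ M u
  augment-path-3 M {u} {w} {x} u-unmatched w-unmatched u≢w Gux x-matched Gmxw =
    M₂ , improves-through-link M u-unmatched u≢x Gux M₂
           (improves-by-edge M₁ mx-unmatched₁ w-unmatched₁ mx≢w Gmxw)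
    where
    u≢x : u ≢ x
    u≢x = unmatched≢matched M u-unmatched x-matched
    mx≢w : mate M x ≢ w
    mx≢w = unmatched≢matched M w-unmatched (mate-matched M x-matched) ∘ sym
    M₁ : PartialMatching G
    M₁ = link M u-unmatched u≢x Gux
    mx-unmatched₁ : Unmatched M₁ (mate M x)
    mx-unmatched₁ = Link.mate-unmatched M u-unmatched u≢x Gux x-matched
    w-unmatched₁ : Unmatched M₁ w
    w-unmatched₁ = Link.still-unmatched M u-unmatched u≢x Gux x-matched w-unmatched (u≢w ∘ sym)
    M₂ : PartialMatching G
    M₂ = link M₁ mx-unmatched₁ mx≢w Gmxw

  augment-path-5 : (M : PartialMatching G) {u v x z : Fin n} → Unmatched M u → Unmatched M v → u ≢ v →
                   G u x → ¬ Unmatched M x → G (mate M x) z → z ≢ x → ¬ Unmatched M z → G (mate M z) v →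
                   ∃ λ M′ → Improves M′ M u
  augment-path-5 M {u} {v} {x} {z} u-unmatched v-unmatched u≢v Gux x-matched Gmxz z≢x z-matched Gmzv =
    Product.map₂ (λ {M₃} → improves-through-link M u-unmatched u≢x Gux M₃)
      (augment-path-3 M₁ mx-unmatched₁ v-unmatched₁ mx≢v Gmxz z-matched₁
        (subst (λ y → G y v) (sym mz-unchanged) Gmzv))
    where
    u≢x : u ≢ x
    u≢x = unmatched≢matched M u-unmatched x-matched
    mx≢v : mate M x ≢ v
    mx≢v = unmatched≢matched M v-unmatched (mate-matched M x-matched) ∘ sym
    M₁ : PartialMatching G
    M₁ = link M u-unmatched u≢x Gux
    mx-unmatched₁ : Unmatched M₁ (mate M x)
    mx-unmatched₁ = Link.mate-unmatched M u-unmatched u≢x Gux x-matched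
    v-unmatched₁ : Unmatched M₁ v
    v-unmatched₁ = Link.still-unmatched M u-unmatched u≢x Gux x-matched v-unmatched (u≢v ∘ sym)
    mz-unchanged : mate M₁ z ≡ mate M z
    mz-unchanged = Link.mate-unchanged M u-unmatched u≢x Gux (unmatched≢matched M u-unmatched z-matched ∘ sym) z≢x
      λ z≡mx → G-irreflexive (subst (G (mate M x)) z≡mx Gmxz)
    z-matched₁ : ¬ Unmatched M₁ z
    z-matched₁ z-unmatched₁ = z-matched (trans (sym mz-unchanged) z-unmatched₁)

  record Stuck (M : PartialMatching G) : Set where
    field
      u v                      : Fin n
      u-unmatched              : Unmatched M u
      v-unmatched              : Unmatched M v
      u≢v                      : u ≢ v
      no-unmatched-neighbour-u : ∀ {w} → Unmatched M w → ¬ G u w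
      no-unmatched-neighbour-v : ∀ {w} → Unmatched M w → ¬ G v w
      no-path-3                : ∀ {x} → G u x → ¬ G v (mate M x)
      no-path-5                : ∀ {x z} → z ≢ x → G u x → G (mate M x) z → ¬ G (mate M z) v

  module _ (G? : ∀ v → Decidable (G v)) where

    unmatched? : (M : PartialMatching G) → Decidable (Unmatched M)
    unmatched? M v = mate M v ≟ v

    Improvement : PartialMatching G → Set
    Improvement M = ∃₂ λ M′ a → Unmatched M a × Improves M′ M a

    private
      at : (M : PartialMatching G) {a : Fin n} → Unmatched M a → ∃ (λ M′ → Improves M′ M a) → Improvement M
      at M a-unmatched (M′ , M′-improves) = M′ , _ , a-unmatched , M′-improves

      by-edge : (M : PartialMatching G) {a b : Fin n} → Unmatched M a → Unmatched M b → G a b → Improvement M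
      by-edge M {a} {b} a-unmatched b-unmatched Gab = at M a-unmatched
        (link M a-unmatched a≢b Gab , improves-by-edge M a-unmatched b-unmatched a≢b Gab)
        where
        a≢b : a ≢ b
        a≢b refl = G-irreflexive Gab

    augment-or-stuck : (M : PartialMatching G) {u v : Fin n} →
                       Unmatched M u → Unmatched M v → u ≢ v → Improvement M ⊎ Stuck M
    augment-or-stuck M {u} {v} u-unmatched v-unmatched u≢v with any? (λ w → unmatched? M w ×-dec G? u w)
    ... | yes (w , w-unmatched , Guw) = inj₁ (by-edge M u-unmatched w-unmatched Guw)
    ... | no ¬u-w with any? (λ w → unmatched? M w ×-dec G? v w)
    ...   | yes (w , w-unmatched , Gvw) = inj₁ (by-edge M v-unmatched w-unmatched Gvw)
    ...   | no ¬v-w with any? (λ x → G? u x ×-dec G? v (mate M x))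
    ...     | yes (x , Gux , Gvmx) = inj₁ (at M u-unmatched
              (augment-path-3 M u-unmatched v-unmatched u≢v Gux (λ x-unmatched → ¬u-w (x , x-unmatched , Gux))
                (G-symmetric Gvmx)))
    ...     | no ¬path-3 with any? (λ x → any? λ z →
                                    ¬? (z ≟ x) ×-dec G? u x ×-dec G? (mate M x) z ×-dec G? (mate M z) v)
    ...       | yes (x , z , z≢x , Gux , Gmxz , Gmzv) = inj₁ (at M u-unmatched
                (augment-path-5 M u-unmatched v-unmatched u≢v Gux (λ x-unmatched → ¬u-w (x , x-unmatched , Gux))
                  Gmxz z≢x
                  (λ z-unmatched → ¬v-w (z , z-unmatched , G-symmetric (subst (λ y → G y v) z-unmatched Gmzv)))
                  Gmzv))
    ...       | no ¬path-5 = inj₂ record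
      { u = u ; v = v ; u-unmatched = u-unmatched ; v-unmatched = v-unmatched ; u≢v = u≢v
      ; no-unmatched-neighbour-u = λ w-unmatched Guw → ¬u-w (_ , w-unmatched , Guw)
      ; no-unmatched-neighbour-v = λ w-unmatched Gvw → ¬v-w (_ , w-unmatched , Gvw)
      ; no-path-3                = λ Gux Gvmx → ¬path-3 (_ , Gux , Gvmx)
      ; no-path-5                = λ z≢x Gux Gmxz Gmzv → ¬path-5 (_ , _ , z≢x , Gux , Gmxz , Gmzv)
      }

    second-unmatched : 2 ∣ n → (M : PartialMatching G) {u : Fin n} → Unmatched M u →
                       ∃ λ v → Unmatched M v × v ≢ u
    second-unmatched 2∣n M {u} u-unmatched = 0<count⇒∃ (unmatched? M ∩? ∁? (_≟ u))
      (positive (subst (2 ∣_) (count-remove (unmatched? M) u-unmatched) 2∣unmatched))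
      where
      2∣matched : 2 ∣ count (∁? (unmatched? M))
      2∣matched = even-count (mate M) (mate-involutive M) (∁? (unmatched? M)) (mate-matched M) id
      2∣unmatched : 2 ∣ count (unmatched? M)
      2∣unmatched = ∣m+n∣m⇒∣n
        (subst (2 ∣_) (trans (sym (count-∁ (unmatched? M))) (+-comm (count (unmatched? M)) _)) 2∣n) 2∣matched
      positive : ∀ {c} → 2 ∣ suc c → 0 < c
      positive {zero}  2∣1 = contradiction (∣1⇒≡1 2∣1) λ ()
      positive {suc c} _   = s≤s z≤n

    perfectMatching-or-stuck : 2 ∣ n → PerfectMatching G ⊎ ∃ Stuck
    perfectMatching-or-stuck 2∣n = go empty-matching (<-wellFounded _)
      where
      go : (M : PartialMatching G) → Acc _<_ (count (unmatched? M)) → PerfectMatching G ⊎ ∃ Stuck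
      go M (acc rec) with any? (unmatched? M)
      ... | no ¬∃unmatched = inj₁ record
        { partner    = mate M
        ; involutive = mate-involutive M
        ; no-fixed   = λ v v-unmatched → ¬∃unmatched (v , v-unmatched)
        ; in-graph   = λ v → mate-adjacent M v λ v-unmatched → ¬∃unmatched (v , v-unmatched)
        }
      ... | yes (u , u-unmatched) with second-unmatched 2∣n M u-unmatched
      ...   | v , v-unmatched , v≢u with augment-or-stuck M u-unmatched v-unmatched (v≢u ∘ sym)
      ...     | inj₂ stuck = inj₂ (M , stuck)
      ...     | inj₁ (M′ , a , a-unmatched , M′-improves) = go M′ (rec
                  (count-strict (unmatched? M′) (unmatched? M) (proj₁ ∘ M′-improves) a-unmatched
                    λ a-unmatched′ → proj₂ (M′-improves a-unmatched′) refl))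

-- Regular graphs of degree d on 2(d + 1) vertices

Closed : Graph n → Pred (Fin n) 0ℓ → Set
Closed G A = ∀ {v w} → A v → G v w → A w

closedNeighbourhood : Graph n → Fin n → Pred (Fin n) 0ℓ
closedNeighbourhood G u w = w ≡ u ⊎ G u w

module Regular {d : ℕ} {G : Graph (suc d + suc d)} (G? : ∀ v → Decidable (G v))
  (G-symmetric : ∀ {v w} → G v w → G w v) (G-irreflexive : ∀ {v} → ¬ G v v)
  (regular : ∀ v → count (G? v) ≡ d) where

  open Augmenting {G = G} G-symmetric G-irreflexive

  swap : {M : PartialMatching G} → Stuck M → Stuck M
  swap {M} S = record
    { u = v ; v = u ; u-unmatched = v-unmatched ; v-unmatched = u-unmatched ; u≢v = u≢v ∘ sym
    ; no-unmatched-neighbour-u = no-unmatched-neighbour-v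
    ; no-unmatched-neighbour-v = no-unmatched-neighbour-u
    ; no-path-3 = λ {x} Gvx Gumx → no-path-3 Gumx (subst (G v) (sym (mate-involutive M x)) Gvx)
    ; no-path-5 = λ {x} {z} z≢x Gvx Gmxz Gmzu → no-path-5 (z≢x ∘ mate-injective M ∘ sym) (G-symmetric Gmzu)
        (subst (λ y → G y (mate M x)) (sym (mate-involutive M z)) (G-symmetric Gmxz))
        (subst (λ y → G y v) (sym (mate-involutive M x)) (G-symmetric Gvx))
    }
    where open Stuck S

  module StuckProperties {M : PartialMatching G} (S : Stuck M) where
    open Stuck S

    |u,v|≡2 : count ((_≟ u) ∪? (_≟ v)) ≡ 2
    |u,v|≡2 = trans (count-∪ (_≟ u) (_≟ v) λ _ (w≡u , w≡v) → u≢v (trans (sym w≡u) w≡v))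
                    (cong₂ _+_ (count-singleton u) (count-singleton v))

    |mate-N[u]|≡d : count (G? u ∘ mate M) ≡ d
    |mate-N[u]|≡d = trans (count-preimage (G? u) (mate M) (mate M) (mate-involutive M) (mate-involutive M)) (regular u)

    u,v∉mate-N[u]∪N[v] : ∀ {w} → (w ≡ u ⊎ w ≡ v) → ¬ (G u (mate M w) ⊎ G v w)
    u,v∉mate-N[u]∪N[v] (inj₁ refl) (inj₁ Gumu) = G-irreflexive (subst (G u) u-unmatched Gumu)
    u,v∉mate-N[u]∪N[v] (inj₁ refl) (inj₂ Gvu)  = no-unmatched-neighbour-v u-unmatched Gvu
    u,v∉mate-N[u]∪N[v] (inj₂ refl) (inj₁ Gumv) = no-unmatched-neighbour-u v-unmatched (subst (G u) v-unmatched Gumv)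
    u,v∉mate-N[u]∪N[v] (inj₂ refl) (inj₂ Gvv)  = G-irreflexive Gvv

    -- The four parts are pairwise disjoint and have 1 + 1 + d + d elements, all there are.
    cover : ∀ w → (w ≡ u ⊎ w ≡ v) ⊎ (G u (mate M w) ⊎ G v w)
    cover w = ⊆-by-count parts? U? (λ _ → tt) (≤-reflexive (trans count-U (sym |parts|≡n))) tt
      where
      parts? : Decidable (((_≡ u) ∪ (_≡ v)) ∪ ((λ w → G u (mate M w)) ∪ G v))
      parts? = ((_≟ u) ∪? (_≟ v)) ∪? ((G? u ∘ mate M) ∪? G? v)
      |parts|≡n : count parts? ≡ suc d + suc d
      |parts|≡n = begin
        count parts?
          ≡⟨ count-∪ ((_≟ u) ∪? (_≟ v)) ((G? u ∘ mate M) ∪? G? v)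
               (λ _ (uv , Nuv) → u,v∉mate-N[u]∪N[v] uv Nuv) ⟩
        count ((_≟ u) ∪? (_≟ v)) + count ((G? u ∘ mate M) ∪? G? v)
          ≡⟨ cong₂ _+_ |u,v|≡2 (count-∪ (G? u ∘ mate M) (G? v) λ w (Gumw , Gvw) →
               no-path-3 Gumw (subst (G v) (sym (mate-involutive M w)) Gvw)) ⟩
        2 + (count (G? u ∘ mate M) + count (G? v))
          ≡⟨ cong₂ (λ c c′ → 2 + (c + c′)) |mate-N[u]|≡d (regular v) ⟩
        2 + (d + d)
          ≡⟨ cong suc (+-suc d d) ⟨
        suc d + suc d ∎
        where open ≡-Reasoning

    -- Otherwise u, mate y, y, z, mate z, v would be an augmenting path.
    neighbour-of-mate-of-neighbour : ∀ {y z} → G u (mate M y) → G y z → z ≢ u → G u z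
    neighbour-of-mate-of-neighbour {y} {z} Gumy Gyz z≢u with cover (mate M z)
    ... | inj₁ (inj₁ mz≡u)  = contradiction (mate-injective M (trans mz≡u (sym u-unmatched))) z≢u
    ... | inj₁ (inj₂ mz≡v)  = contradiction (mate-injective M (trans mz≡v (sym v-unmatched)))
                                λ { refl → no-path-3 Gumy (subst (G v) (sym (mate-involutive M y)) (G-symmetric Gyz)) }
    ... | inj₂ (inj₁ Gummz) = subst (G u) (mate-involutive M z) Gummz
    ... | inj₂ (inj₂ Gvmz) with z ≟ mate M y
    ...   | yes refl = ⊥-elim (no-path-3 Gumy Gvmz)
    ...   | no z≢my  = ⊥-elim (no-path-5 z≢my Gumy (subst (λ x → G x z) (sym (mate-involutive M y)) Gyz)
                                (G-symmetric Gvmz))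

  module _ {M : PartialMatching G} (S : Stuck M) where
    open Stuck S
    open StuckProperties S
    private module Swapped = StuckProperties (swap S)

    neighbours-of-common-mate : ∀ {y z} → G u (mate M y) → G v (mate M y) → G y z → G u z × G v z
    neighbours-of-common-mate {y} {z} Gumy Gvmy Gyz with z ≟ u | z ≟ v
    ... | yes refl | _        = ⊥-elim (no-unmatched-neighbour-v u-unmatched
                                  (Swapped.neighbour-of-mate-of-neighbour Gvmy Gyz u≢v))
    ... | no _     | yes refl = ⊥-elim (no-unmatched-neighbour-u v-unmatched
                                  (neighbour-of-mate-of-neighbour Gumy Gyz (u≢v ∘ sym)))
    ... | no z≢u   | no z≢v   = neighbour-of-mate-of-neighbour Gumy Gyz z≢u ,
                                Swapped.neighbour-of-mate-of-neighbour Gvmy Gyz z≢v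

    -- A common neighbour w would force N(y) = N(u) = N(v) for every mate y of a neighbour
    -- of u, so w would be adjacent to these d vertices and to u and v.
    disjoint-neighbourhoods : ∀ {w} → G u w → ¬ G v w
    disjoint-neighbourhoods {w} Guw Gvw = ℕₚ.m+1+n≰m d (begin
      d + 2                                         ≡⟨ cong₂ _+_ |mate-N[u]|≡d |u,v|≡2 ⟨
      count (G? u ∘ mate M) + count ((_≟ u) ∪? (_≟ v))
        ≡⟨ count-∪ (G? u ∘ mate M) ((_≟ u) ∪? (_≟ v))
             (λ _ (Gumy , uv) → u,v∉mate-N[u]∪N[v] uv (inj₁ Gumy)) ⟨
      count ((G? u ∘ mate M) ∪? ((_≟ u) ∪? (_≟ v)))
        ≤⟨ count-mono ((G? u ∘ mate M) ∪? ((_≟ u) ∪? (_≟ v))) (G? w) adjacent-to-w ⟩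
      count (G? w)                                  ≡⟨ regular w ⟩
      d                                             ∎)
      where
      open ≤-Reasoning
      same-neighbours : ∀ {y} → G u (mate M y) → G v (mate M y) → G u ⊆ G y
      same-neighbours Gumy Gvmy = ⊆-by-count (G? _) (G? u) (proj₁ ∘ neighbours-of-common-mate Gumy Gvmy)
        (≤-reflexive (trans (regular u) (sym (regular _))))
      Gummw : G u (mate M (mate M w))
      Gummw = subst (G u) (sym (mate-involutive M w)) Guw
      Gvmmw : G v (mate M (mate M w))
      Gvmmw = subst (G v) (sym (mate-involutive M w)) Gvw
      N[u]⊆N[v] : G u ⊆ G v
      N[u]⊆N[v] = proj₂ ∘ neighbours-of-common-mate Gummw Gvmmw ∘ same-neighbours Gummw Gvmmw
      adjacent-to-w : (λ y → G u (mate M y)) ∪ ((_≡ u) ∪ (_≡ v)) ⊆ G w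
      adjacent-to-w (inj₁ Gumy)        = G-symmetric (same-neighbours Gumy (N[u]⊆N[v] Gumy) Guw)
      adjacent-to-w (inj₂ (inj₁ refl)) = G-symmetric Guw
      adjacent-to-w (inj₂ (inj₂ refl)) = G-symmetric Gvw

    neighbourhood-mate-closed : ∀ {w} → G u w → G u (mate M w)
    neighbourhood-mate-closed {w} Guw with cover w
    ... | inj₁ (inj₁ refl) = ⊥-elim (G-irreflexive Guw)
    ... | inj₁ (inj₂ refl) = ⊥-elim (no-unmatched-neighbour-u v-unmatched Guw)
    ... | inj₂ (inj₁ Gumw) = Gumw
    ... | inj₂ (inj₂ Gvw)  = ⊥-elim (disjoint-neighbourhoods Guw Gvw)

    closedNeighbourhood-closed : Closed G (closedNeighbourhood G u)
    closedNeighbourhood-closed (inj₁ refl) Guz = inj₂ Guz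
    closedNeighbourhood-closed {w = z} (inj₂ Guw) Gwz with z ≟ u
    ... | yes z≡u = inj₁ z≡u
    ... | no z≢u  = inj₂ (neighbour-of-mate-of-neighbour (neighbourhood-mate-closed Guw) Gwz z≢u)

    even-degree : 2 ∣ d
    even-degree = subst (2 ∣_) (regular u) (even-count (mate M) (mate-involutive M) (G? u)
      neighbourhood-mate-closed λ Guw mw≡w → no-unmatched-neighbour-u mw≡w Guw)

  perfectMatching-or-closedNeighbourhood :
    PerfectMatching G ⊎ ∃ λ u → Closed G (closedNeighbourhood G u) × 2 ∣ d
  perfectMatching-or-closedNeighbourhood with perfectMatching-or-stuck G? (2∣n+n (suc d))
  ... | inj₁ perfect = inj₁ perfect
  ... | inj₂ (M , S) = inj₂ (Stuck.u S , closedNeighbourhood-closed S , even-degree S)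

-- Complete bipartite graphs K_{k,k}

module _ {k : ℕ} {H : Graph (k + k)} (H? : ∀ v → Decidable (H v)) (H-symmetric : ∀ {v w} → H v w → H w v)
  (regular : ∀ v → count (H? v) ≡ k) where

  complete-bipartite-by-degree : {A : Pred (Fin (k + k)) 0ℓ} (A? : Decidable A) → count A? ≡ k →
    (∀ {v w} → A v → ¬ A w → H v w) → ∀ v w → H v w ⇔ ((A v × ¬ A w) ⊎ (¬ A v × A w))
  complete-bipartite-by-degree {A} A? |A|≡k cross v w = mk⇔ (by-cases (A? v) (A? w))
    Sum.[ (λ (a , ¬b) → cross a ¬b) , (λ (¬a , b) → H-symmetric (cross b ¬a)) ]
    where
    neighbours⊆ : {P : Pred (Fin (k + k)) 0ℓ} (P? : Decidable P) → count P? ≡ k → P ⊆ H v → H v ⊆ P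
    neighbours⊆ P? |P|≡k P⊆Hv = ⊆-by-count P? (H? v) P⊆Hv (≤-reflexive (trans (regular v) (sym |P|≡k)))
    by-cases : Dec (A v) → Dec (A w) → H v w → (A v × ¬ A w) ⊎ (¬ A v × A w)
    by-cases (yes a) (yes b) Hvw = contradiction b (neighbours⊆ (∁? A?) (count-∁-half A? |A|≡k) (cross a) Hvw)
    by-cases (yes a) (no ¬b) _   = inj₁ (a , ¬b)
    by-cases (no ¬a) (yes b) _   = inj₂ (¬a , b)
    by-cases (no ¬a) (no ¬b) Hvw = contradiction (neighbours⊆ A? |A|≡k (λ b → H-symmetric (cross b ¬a)) Hvw) ¬b

even-by-perfectMatching : ∀ {k} {G H : Graph (k + k)} → PerfectMatching G → (∀ {v w} → G v w → ¬ H v w) →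
                          H ≅ CompleteBipartite k k → 2 ∣ k
even-by-perfectMatching {k} M G∩H≡∅ H≅K = subst (2 ∣_) |A|≡k
  (even-count (partner M) (involutive M) A? partner-stays (λ {v} _ → no-fixed M v))
  where
  open _≅_ H≅K
  σ : Fin (k + k) → Fin (k + k)
  σ = Inverse.to bij
  A? : Decidable (λ v → toℕ (σ v) < k)
  A? v = toℕ (σ v) ℕ.<? k
  partner-stays : ∀ {v} → toℕ (σ v) < k → toℕ (σ (partner M v)) < k
  partner-stays {v} σv<k = decidable-stable (A? (partner M v)) λ σmv≮k →
    G∩H≡∅ (in-graph M v) (Equivalence.from (edges v (partner M v)) (inj₁ (σv<k , ℕₚ.≮⇒≥ σmv≮k)))
  |A|≡k : count A? ≡ k
  |A|≡k = trans (count-preimage (λ i → toℕ i ℕ.<? k) σ (Inverse.from bij)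
                   (Inverse.strictlyInverseˡ bij) (Inverse.strictlyInverseʳ bij))
                (count-toℕ< k (m≤m+n k k))

-- Tournaments

module _ {k : ℕ} (T : Tournament (k + k) k) where

  private
    opponent : Fin k → Fin (k + k) → Fin (k + k)
    opponent i = partner (round T i)

  coFeasibility? : ∀ v → Decidable (coFeasibility T v)
  coFeasibility? v = image? λ i → opponent i v

  coFeasibility-symmetric : ∀ {v w} → coFeasibility T v w → coFeasibility T w v
  coFeasibility-symmetric {v} (i , refl) = i , involutive (round T i) v

  |coFeasibility|≡k : ∀ v → count (coFeasibility? v) ≡ k
  |coFeasibility|≡k v = ≤-antisym (count-image≤ (λ i → opponent i v)) (begin
    k                        ≡⟨ count-U ⟨
    count (U? {A = Fin k})   ≤⟨ count-injection U? (coFeasibility? v) (λ i → opponent i v) (λ {i} _ → i , refl)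
                                  (λ {i} {j} _ _ → disjoint T i j v _ refl ∘ sym) ⟩
    count (coFeasibility? v) ∎)
    where open ≤-Reasoning

  feasibility? : ∀ v → Decidable (feasibility T v)
  feasibility? v w = ¬? (v ≟ w) ×-dec ¬? (coFeasibility? v w)

  feasibility-symmetric : ∀ {v w} → feasibility T v w → feasibility T w v
  feasibility-symmetric (v≢w , ¬co) = v≢w ∘ sym , ¬co ∘ coFeasibility-symmetric

  feasibility-irreflexive : ∀ {v} → ¬ feasibility T v v
  feasibility-irreflexive (v≢v , _) = v≢v refl

  1+|feasibility|≡k : ∀ v → suc (count (feasibility? v)) ≡ k
  1+|feasibility|≡k v = ℕₚ.+-cancelˡ-≡ k _ _ (begin
    k + suc (count (feasibility? v))  ≡⟨ +-suc k _ ⟩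
    suc k + count (feasibility? v)
      ≡⟨ cong₂ _+_ |v∪co|≡1+k (count-cong (∁? v∪co?) (feasibility? v) (∉⇒feasible , feasible⇒∉)) ⟨
    count v∪co? + count (∁? v∪co?)    ≡⟨ count-∁ v∪co? ⟩
    k + k                             ∎)
    where
    open ≡-Reasoning
    v∪co? : Decidable ((_≡ v) ∪ coFeasibility T v)
    v∪co? = (_≟ v) ∪? coFeasibility? v
    |v∪co|≡1+k : count v∪co? ≡ suc k
    |v∪co|≡1+k = trans
      (count-∪ (_≟ v) (coFeasibility? v) λ { _ (refl , i , opp≡v) → no-fixed (round T i) v opp≡v })
      (cong₂ _+_ (count-singleton v) (|coFeasibility|≡k v))
    feasible⇒∉ : feasibility T v ⊆ ∁ ((_≡ v) ∪ coFeasibility T v)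
    feasible⇒∉ (v≢w , ¬co) = Sum.[ v≢w ∘ sym , ¬co ]
    ∉⇒feasible : ∁ ((_≡ v) ∪ coFeasibility T v) ⊆ feasibility T v
    ∉⇒feasible ∉ = ∉ ∘ inj₁ ∘ sym , ∉ ∘ inj₂

  coFeasibility≅K-by-closedNeighbourhood : ∀ u → Closed (feasibility T) (closedNeighbourhood (feasibility T) u) →
                                            coFeasibility T ≅ CompleteBipartite k k
  coFeasibility≅K-by-closedNeighbourhood u closed = ≅-CompleteBipartite A? |A|≡k
    (complete-bipartite-by-degree coFeasibility? coFeasibility-symmetric |coFeasibility|≡k A? |A|≡k cross)
    where
    A? : Decidable (closedNeighbourhood (feasibility T) u)
    A? = (_≟ u) ∪? feasibility? u
    |A|≡k : count A? ≡ k
    |A|≡k = trans (count-∪ (_≟ u) (feasibility? u) λ { _ (refl , w≢w , _) → w≢w refl })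
                  (trans (cong (_+ count (feasibility? u)) (count-singleton u)) (1+|feasibility|≡k u))
    cross : ∀ {v w} → closedNeighbourhood (feasibility T) u v → ¬ closedNeighbourhood (feasibility T) u w →
            coFeasibility T v w
    cross {v} {w} v∈A w∉A = decidable-stable (coFeasibility? v w) λ ¬co →
      w∉A (closed v∈A ((λ { refl → w∉A v∈A }) , ¬co))

proposition3 : (k : ℕ) → 1 ≤ k → (T : Tournament (k + k) k) →
    (¬ Extendable T) ⇔ ((coFeasibility T ≅ CompleteBipartite k k) × ¬ (2 ∣ k))
proposition3 (suc d) _ T = mk⇔ non-extendable⇒bipartite bipartite⇒non-extendable
  where
  open Regular (feasibility? T) (feasibility-symmetric T) (feasibility-irreflexive T)
               (ℕₚ.suc-injective ∘ 1+|feasibility|≡k T)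

  non-extendable⇒bipartite : ¬ Extendable T →
                             (coFeasibility T ≅ CompleteBipartite (suc d) (suc d)) × ¬ (2 ∣ suc d)
  non-extendable⇒bipartite ¬extendable with perfectMatching-or-closedNeighbourhood
  ... | inj₁ perfect             = contradiction perfect ¬extendable
  ... | inj₂ (u , closed , 2∣d) = coFeasibility≅K-by-closedNeighbourhood T u closed , 2∣n⇒2∤1+n 2∣d

  bipartite⇒non-extendable : (coFeasibility T ≅ CompleteBipartite (suc d) (suc d)) × ¬ (2 ∣ suc d) →
                             ¬ Extendable T
  bipartite⇒non-extendable (Ḡ≅K , odd) perfect = odd (even-by-perfectMatching perfect proj₂ Ḡ≅K)
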